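{- Let $f_0,\dots,f_m\colon\{ -1,1\}^n\to\mathbb R$ and $g_0,\dots,g_n\colon\{ -1,1\}^m\to\mathbb R$ form a multilinear generalized polymorphism with $f_1,\dots,f_m,g_1,\dots,g_n$ non-constant, and let $Z_\ell$ be one of its blocks. Let $\emptyset\ne I\subsetneq\mathrm{rows}(Z_\ell)$. Then there exist $i_0\in I$, $i_1\in\mathrm{rows}(Z_\ell)\setminus I$ and $w\in[m]$ such that both $g_{i_0}$ and $g_{i_1}$ depend on the coordinate $w$.
   Context: A multilinear generalized polymorphism: functions $f_0,\dots,f_m\colon\{ -1,1\}^n\to\mathbb R$, $g_0,\dots,g_n\colon\{ -1,1\}^m\to\mathbb R$ with $f_0(g_1(z_{1\cdot}),\dots,g_n(z_{n\cdot}))=g_0(f_1(z_{\cdot1}),\dots,f_m(z_{\cdot m}))$ for all $z\in\{ -1,1\}^{[n]\times[m]}$, where $z_{i\cdot}=(z_{i1},\dots,z_{im})$, $z_{\cdot j}=(z_{1j},\dots,z_{nj})$. $Z_0\subseteq[n]\times[m]$ is the set of $(i,j)$ such that the common composed function depends on $z_{ij}$; the blocks $Z_1,\dots,Z_k$ are the connected components of the graph on $Z_0$ in which two distinct elements are adjacent iff they share the first or the second coordinate. $\mathrm{rows}(W)$ is the projection of $W\subseteq[n]\times[m]$ onto its first coordinate. -}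

module Defs where

open import Level using (0ℓ)
open import Data.Nat using (ℕ; zero; suc)
open import Data.Fin using (Fin; zero; suc)
open import Data.Fin.Properties using () renaming (_≟_ to _≟ᶠ_)
open import Data.Bool using (Bool; true; false; not; if_then_else_)
open import Data.Product using (Σ; ∃; ∃-syntax; _×_; _,_; proj₁; proj₂)
open import Data.Sum using (_⊎_)
open import Data.Vec.Functional using (_∷_; tail)
open import Relation.Nullary using (¬_; Dec; yes; no; does)
open import Relation.Binary.PropositionalEquality using (_≡_; _≢_)
open import Relation.Binary.Structures using (IsStrictTotalOrder)
open import Relation.Binary.Construct.Closure.ReflexiveTransitive using (Star)
open import Algebra.Structures using (IsCommutativeRing)

-- Any model is isomorphic to ℝ, so quantifying over all models is the
-- same as stating the result for ℝ.  Equality is propositional; the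
-- strict total order makes equality and order decidable (as they are
-- classically for ℝ).  Inverse is total with 0⁻¹ unspecified.

record RealNumbers : Set₁ where
  infixl 7 _*_
  infixl 6 _+_ _-_
  infix 4 _<_
  field
    Carrier : Set
    0# 1#   : Carrier
    _+_ _*_ : Carrier → Carrier → Carrier
    -_      : Carrier → Carrier
    _⁻¹     : Carrier → Carrier
    _<_     : Carrier → Carrier → Set
    isCommutativeRing : IsCommutativeRing _≡_ _+_ _*_ -_ 0# 1#
    0≢1     : 0# ≢ 1#
    ⁻¹-inverse : ∀ x → x ≢ 0# → x * (x ⁻¹) ≡ 1#
    isStrictTotalOrder : IsStrictTotalOrder _≡_ _<_
    +-mono-< : ∀ {x y} z → x < y → x + z < y + z
    *-pos    : ∀ {x y} → 0# < x → 0# < y → 0# < x * y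
    sup : (P : Carrier → Set) → ∃ P → (∃[ b ] (∀ x → P x → ¬ (b < x))) →
          ∃[ s ] ((∀ x → P x → ¬ (s < x)) ×
                  (∀ b → (∀ x → P x → ¬ (b < x)) → ¬ (b < s)))

  _-_ : Carrier → Carrier → Carrier
  x - y = x + (- y)

  half : Carrier
  half = (1# + 1#) ⁻¹

-- Boolean cube {-1,1}^n, encoded as Fin n → Bool with true ↦ +1, false ↦ -1.

Cube : ℕ → Set
Cube n = Fin n → Bool

flipAt : ∀ {n} → Fin n → Cube n → Cube n
flipAt i x k = if does (k ≟ᶠ i) then not (x k) else x k

flipAt₂ : ∀ {n m} → Fin n → Fin m → (Fin n → Cube m) → (Fin n → Cube m)
flipAt₂ i j z i' = if does (i' ≟ᶠ i) then flipAt j (z i') else z i'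

module WithReals (ℝ : RealNumbers) where
  open RealNumbers ℝ

  -- multilinear extension of f : {-1,1}^n → ℝ to ℝ^n:
  -- ext f x = Σ_a f(a) Π_i (1 + a_i x_i)/2
  ext : ∀ {n} → (Cube n → Carrier) → (Fin n → Carrier) → Carrier
  ext {zero}  f x = f (λ ())
  ext {suc n} f x =
    half * ((1# + x zero) * ext (λ c → f (true ∷ c)) (tail x)
          + (1# - x zero) * ext (λ c → f (false ∷ c)) (tail x))

  DependsOn : ∀ {n} → (Cube n → Carrier) → Fin n → Set
  DependsOn f i = ∃[ x ] (f x ≢ f (flipAt i x))

  NonConstant : ∀ {n} → (Cube n → Carrier) → Set
  NonConstant f = ∃[ x ] ∃[ y ] (f x ≢ f y)

  module Polymorphism {n m : ℕ}
      (f₀ : Cube n → Carrier) (fs : Fin m → Cube n → Carrier)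
      (g₀ : Cube m → Carrier) (gs : Fin n → Cube m → Carrier) where

    composed : (Fin n → Cube m) → Carrier
    composed z = ext f₀ (λ i → gs i (z i))

    IsPolymorphism : Set
    IsPolymorphism = ∀ (z : Fin n → Cube m) →
      ext f₀ (λ i → gs i (z i)) ≡ ext g₀ (λ j → fs j (λ i → z i j))

    Z₀ : Fin n × Fin m → Set
    Z₀ (i , j) = ∃[ z ] (composed z ≢ composed (flipAt₂ i j z))

    Adj : Fin n × Fin m → Fin n × Fin m → Set
    Adj p q = Z₀ p × Z₀ q × p ≢ q × (proj₁ p ≡ proj₁ q ⊎ proj₂ p ≡ proj₂ q)

    InBlock : Fin n × Fin m → Fin n × Fin m → Set
    InBlock p q = Z₀ q × Star Adj p q

    Rows : Fin n × Fin m → Fin n → Set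
    Rows p i = ∃[ j ] InBlock p (i , j)

-- The block is connected through Z₀, so any path inside it from a row of I
-- to a row outside I has an edge leaving I; that edge joins two cells of Z₀
-- in different rows, hence in a common column w.  The composed function can
-- only depend on z_{iw} if g_i depends on w, so both rows' g depend on w.
module Submission where

open import Defs
open import Data.Nat using (ℕ; zero; suc)
open import Data.Fin using (Fin; zero; suc)
open import Data.Fin.Subset using (Subset; _∈_; _∉_)
open import Data.Fin.Subset.Properties using (_∈?_)
open import Data.Fin.Properties using () renaming (_≟_ to _≟ᶠ_)
open import Data.Product using (∃-syntax; _×_; _,_; proj₁; proj₂)
open import Data.Sum using (inj₁; inj₂)
import Data.Sum as Sum
open import Data.Empty using (⊥-elim)
open import Data.Bool using (true; false)
open import Data.Vec.Functional using (_∷_)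
open import Function using (_∘_)
open import Relation.Nullary using (¬_; yes; no)
open import Relation.Unary using (Pred; Decidable)
open import Relation.Binary using (Rel; Symmetric)
open import Relation.Binary.PropositionalEquality using (_≡_; _≢_; refl; sym; cong₂)
open import Relation.Binary.Construct.Closure.ReflexiveTransitive
  using (Star; ε; _◅_; _◅◅_; reverse)

Star-exit : ∀ {a r p} {A : Set a} {R : Rel A r} {P : Pred A p} → Decidable P →
            ∀ {x y} → Star R x y → P x → ¬ P y →
            ∃[ u ] ∃[ v ] (Star R x u × R u v × P u × ¬ P v)
Star-exit P? ε         Px ¬Py = ⊥-elim (¬Py Px)
Star-exit P? {x} (_◅_ {j = x′} x→x′ x′→y) Px ¬Py with P? x′
... | no ¬Px′ = x , x′ , ε , x→x′ , Px , ¬Px′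
... | yes Px′ with Star-exit P? x′→y Px′ ¬Py
...   | u , v , x′→u , u→v , Pu , ¬Pv = u , v , x→x′ ◅ x′→u , u→v , Pu , ¬Pv

module _ (ℝ : RealNumbers) where
  open RealNumbers ℝ
  open WithReals ℝ

  ext-cong : ∀ {n} (f : Cube n → Carrier) {x y : Fin n → Carrier} →
             (∀ i → x i ≡ y i) → ext f x ≡ ext f y
  ext-cong {zero}  f x≗y = refl
  ext-cong {suc n} f x≗y =
    cong₂ (λ x₀ e → half * ((1# + x₀) * proj₁ e + (1# - x₀) * proj₂ e))
      (x≗y zero)
      (cong₂ _,_ (ext-cong (λ c → f (true ∷ c)) (x≗y ∘ suc))
                 (ext-cong (λ c → f (false ∷ c)) (x≗y ∘ suc)))

  module _ {n m : ℕ}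
      (f₀ : Cube n → Carrier) (fs : Fin m → Cube n → Carrier)
      (g₀ : Cube m → Carrier) (gs : Fin n → Cube m → Carrier) where
    open Polymorphism f₀ fs g₀ gs

    Z₀⇒DependsOn : ∀ i w → Z₀ (i , w) → DependsOn (gs i) w
    Z₀⇒DependsOn i w (z , composed-changes) =
      z i , λ gᵢ-unchanged → composed-changes (ext-cong f₀ (inputs-unchanged gᵢ-unchanged))
      where
      inputs-unchanged : gs i (z i) ≡ gs i (flipAt w (z i)) →
                         ∀ k → gs k (z k) ≡ gs k (flipAt₂ i w z k)
      inputs-unchanged eq k with k ≟ᶠ i
      ... | yes refl = eq
      ... | no _     = refl

    Adj-sym : Symmetric Adj
    Adj-sym (Z₀p , Z₀q , p≢q , shared) =
      Z₀q , Z₀p , p≢q ∘ sym , Sum.map sym sym shared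

    Adj-column : ∀ {p q} → Adj p q → proj₁ p ≢ proj₁ q → proj₂ p ≡ proj₂ q
    Adj-column (_ , _ , _ , inj₁ same-row)    different-rows = ⊥-elim (different-rows same-row)
    Adj-column (_ , _ , _ , inj₂ same-column) _              = same-column

    Adj⇒common-dependency : ∀ {a b w w′} → Adj (a , w) (b , w′) → a ≢ b →
                            DependsOn (gs a) w × DependsOn (gs b) w
    Adj⇒common-dependency {a} {b} {w} adj a≢b with Adj-column adj a≢b
    ... | refl = Z₀⇒DependsOn a w (proj₁ adj) , Z₀⇒DependsOn b w (proj₁ (proj₂ adj))

lemma2p12 : (ℝ : RealNumbers) (n m : ℕ)
    (f₀ : Cube n → RealNumbers.Carrier ℝ) (fs : Fin m → Cube n → RealNumbers.Carrier ℝ)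
    (g₀ : Cube m → RealNumbers.Carrier ℝ) (gs : Fin n → Cube m → RealNumbers.Carrier ℝ) →
    WithReals.Polymorphism.IsPolymorphism ℝ f₀ fs g₀ gs →
    (∀ j → WithReals.NonConstant ℝ (fs j)) →
    (∀ i → WithReals.NonConstant ℝ (gs i)) →
    (p : Fin n × Fin m) → WithReals.Polymorphism.Z₀ ℝ f₀ fs g₀ gs p →
    (I : Subset n) →
    (∃[ i ] (i ∈ I)) →
    (∀ i → i ∈ I → WithReals.Polymorphism.Rows ℝ f₀ fs g₀ gs p i) →
    (∃[ i ] (WithReals.Polymorphism.Rows ℝ f₀ fs g₀ gs p i × i ∉ I)) →
    ∃[ i₀ ] ∃[ i₁ ] ∃[ w ]
    (i₀ ∈ I × WithReals.Polymorphism.Rows ℝ f₀ fs g₀ gs p i₁ × i₁ ∉ I ×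
    WithReals.DependsOn ℝ (gs i₀) w × WithReals.DependsOn ℝ (gs i₁) w)
lemma2p12 ℝ n m f₀ fs g₀ gs _ _ _ p _ I (i , i∈I) I⊆rows (i′ , (j′ , _ , p→q′) , i′∉I)
  with I⊆rows i i∈I
... | j , _ , p→q
  with Star-exit (λ q → proj₁ q ∈? I) (reverse (Adj-sym ℝ f₀ fs g₀ gs) p→q ◅◅ p→q′) i∈I i′∉I
... | (a , w) , (b , w′) , q→u , u→v , a∈I , b∉I =
  a , b , w , a∈I , (w′ , proj₁ (proj₂ u→v) , p→q ◅◅ q→u ◅◅ (u→v ◅ ε)) , b∉I ,
  Adj⇒common-dependency ℝ f₀ fs g₀ gs u→v (λ { refl → b∉I a∈I })
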